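{- Let $n\ge1$, $\lambda=2^n$, and let $c_1,\dots,c_n$ be nonnegative integers. Then there exists a (unique) standard Young tableau $T$ of shape $\lambda$ whose first-column entries $a_1,\dots,a_n$ (top to bottom) satisfy $\operatorname{dep}(a_i)=c_i$ for all $1\le i\le n$ if and only if $c_1=0$ and $c_i\le c_{i-1}+1$ for all $i>1$.
   Context: $\lambda=2^n$ is the shape with $n$ rows of length $2$. A standard Young tableau is a filling by $1,\dots,2n$ increasing along rows and down columns. For an entry $a$ in column $j$, $\operatorname{dep}(a)$ is the number of entries of column $j$ smaller than $a$ minus the number of entries of column $j+1$ smaller than $a$ (the latter $0$ if there is no column $j+1$). -}

module Defs where

open import Data.Nat using (ℕ; zero; suc; _+_; _<_; _≤_; _<?_)
open import Data.Fin using (Fin; toℕ) renaming (_<_ to _<ᶠ_)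
open import Data.Vec using (Vec; lookup; count; toList)
open import Data.List using (List; _++_; map; upTo)
open import Data.List.Relation.Binary.Permutation.Propositional using (_↭_)
open import Data.Product using (_×_; proj₁; proj₂)
open import Data.Integer using (ℤ; +_; _-_)
open import Relation.Binary.PropositionalEquality using (_≡_)

-- A filling of the shape λ = 2^n (n rows of length 2), stored column-wise:
-- proj₁ T = first column (top to bottom), proj₂ T = second column.
Filling : ℕ → Set
Filling n = Vec ℕ n × Vec ℕ n

col₁ col₂ : ∀ {n} → Filling n → Vec ℕ n
col₁ = proj₁
col₂ = proj₂

record IsSYT {n : ℕ} (T : Filling n) : Set where
  field
    entries  : (toList (col₁ T) ++ toList (col₂ T)) ↭ map suc (upTo (n + n))
    rowsInc  : ∀ (i : Fin n) → lookup (col₁ T) i < lookup (col₂ T) i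
    col₁Inc  : ∀ (i j : Fin n) → i <ᶠ j → lookup (col₁ T) i < lookup (col₁ T) j
    col₂Inc  : ∀ (i j : Fin n) → i <ᶠ j → lookup (col₂ T) i < lookup (col₂ T) j

#smaller : ∀ {n} → ℕ → Vec ℕ n → ℕ
#smaller a v = count (_<? a) v

dep₁ : ∀ {n} → Filling n → ℕ → ℤ
dep₁ T a = + #smaller a (col₁ T) - + #smaller a (col₂ T)

HasDeps : ∀ {n} → (Fin n → ℕ) → Filling n → Set
HasDeps {n} c T = ∀ (i : Fin n) → dep₁ T (lookup (col₁ T) i) ≡ + c i

-- c₁ = 0 and c_i ≤ c_{i-1} + 1 for all i > 1 (indices 0-based in Fin n)
DepCondition : ∀ {n} → (Fin n → ℕ) → Set
DepCondition {n} c =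
  (∀ (i : Fin n) → toℕ i ≡ 0 → c i ≡ 0) ×
  (∀ (i j : Fin n) → toℕ j ≡ suc (toℕ i) → c j ≤ suc (c i))

module Submission where

-- Write a_i for the i-th entry of the first column (i = 0, …, n-1) of a
-- standard Young tableau T of shape 2^n, and q_i for the number of entries of
-- the second column below a_i.  Since the entries of T are 1, …, 2n, exactly
-- a_i - 1 entries lie below a_i, and i of them are in the first column, so
--     a_i = 1 + i + q_i    and    dep(a_i) = i - q_i.
-- Hence dep(a_i) = c_i iff i = c_i + q_i.  This gives the three parts:
--   * necessity: q_0 = 0 forces c_0 = 0, and q_i ≤ q_{i+1} forces
--     c_{i+1} ≤ c_i + 1;
--   * uniqueness: a_i = 1 + i + (i - c_i) is determined by c, and the second
--     column is determined by the first, because an increasing vector is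
--     determined by its counting function x ↦ #{entries < x};
--   * existence: for k_i = i - c_i (monotone, k_i ≤ i) put a_i = 1 + i + k_i
--     and b_j = 1 + j + m_j with m_j = #{i : k_i ≤ j}; the two columns
--     interleave to 1, …, 2n, and the resulting tableau is standard.

open import Defs
open import Data.Nat using (ℕ; zero; suc; _+_; _∸_; _≤_; _<_; _<?_; _≟_; z≤n; s≤s)
open import Data.Nat.Properties
open import Data.Fin using (Fin; toℕ; fromℕ<) renaming (zero to fzero; suc to fsuc; _<_ to _<ᶠ_; _≤_ to _≤ᶠ_)
open import Data.Fin.Properties using (toℕ-fromℕ<; toℕ-injective; toℕ<n)
open import Data.Vec using (Vec; []; _∷_; lookup; toList; tabulate)
open import Data.Vec.Properties using (count≤n; lookup∘tabulate; tabulate∘lookup; tabulate-cong)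
open import Data.Vec.Membership.Propositional.Properties using (∈-lookup; ∈-toList⁺)
open import Data.List using (List; []; _∷_; _++_; map; upTo; applyUpTo; length; filter)
open import Data.List.Properties using (length-++; filter-++; filter-accept; filter-reject; filter-none; map-upTo; map-∘)
open import Data.List.Membership.Propositional using (_∈_)
open import Data.List.Membership.Propositional.Properties using (∈-++⁺ˡ; ∈-++⁺ʳ)
import Data.List.Relation.Unary.All as All
open import Data.List.Relation.Unary.Any using (here; there)
open import Data.List.Relation.Binary.Permutation.Propositional using (_↭_; ↭-sym)
open import Data.List.Relation.Binary.Permutation.Propositional.Properties using (filter-↭; ↭-length; ∈-resp-↭)
open import Data.List.Relation.Ternary.Interleaving.Propositional using (Interleaving; []; _∷ˡ_; _∷ʳ_; toPermutation)
open import Data.Product using (∃!; Σ; _×_; _,_; proj₁; proj₂)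
import Data.Integer as ℤ
import Data.Integer.Properties as ℤ
open import Data.Integer.Solver using (module +-*-Solver)
open import Data.Empty using (⊥-elim)
open import Data.Sum using (inj₁; inj₂)
open import Function using (_∘_)
open import Function.Bundles using (_⇔_; mk⇔; Equivalence)
open import Relation.Binary.Definitions using (tri<; tri≈; tri>)
open import Relation.Binary.PropositionalEquality using (_≡_; refl; sym; trans; cong; cong₂; subst; subst₂; module ≡-Reasoning)
open import Relation.Nullary using (¬_; yes; no)
open import Relation.Nullary.Decidable using (dec-true; dec-false)

#below : ℕ → List ℕ → ℕ
#below x xs = length (filter (_<? x) xs)

#below-++ : ∀ x xs ys → #below x (xs ++ ys) ≡ #below x xs + #below x ys
#below-++ x xs ys = trans (cong length (filter-++ (_<? x) xs ys)) (length-++ (filter (_<? x) xs))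

#below-↭ : ∀ x {xs ys} → xs ↭ ys → #below x xs ≡ #below x ys
#below-↭ x p = ↭-length (filter-↭ (_<? x) p)

interval : ℕ → ℕ → List ℕ
interval s zero    = []
interval s (suc r) = s ∷ interval (suc s) r

map-suc-interval : ∀ s r → map suc (interval s r) ≡ interval (suc s) r
map-suc-interval s zero    = refl
map-suc-interval s (suc r) = cong (suc s ∷_) (map-suc-interval (suc s) r)

range≡interval : ∀ r → map suc (upTo r) ≡ interval 1 r
range≡interval r = trans (cong (map suc) (upTo≡interval r)) (map-suc-interval 0 r)
  where
  upTo≡interval : ∀ r → upTo r ≡ interval 0 r
  upTo≡interval zero    = refl
  upTo≡interval (suc r) = cong (0 ∷_) (begin
    applyUpTo suc r           ≡⟨ map-upTo suc r ⟨
    map suc (upTo r)          ≡⟨ cong (map suc) (upTo≡interval r) ⟩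
    map suc (interval 0 r)    ≡⟨ map-suc-interval 0 r ⟩
    interval 1 r              ∎)
    where open ≡-Reasoning

toList-tabulate : ∀ {r} (f : ℕ → ℕ) → toList (tabulate {n = r} (f ∘ toℕ)) ≡ map f (interval 0 r)
toList-tabulate {zero}  f = refl
toList-tabulate {suc r} f = cong (f 0 ∷_) (begin
  toList (tabulate {n = r} ((f ∘ suc) ∘ toℕ))  ≡⟨ toList-tabulate (f ∘ suc) ⟩
  map (f ∘ suc) (interval 0 r)                 ≡⟨ map-∘ (interval 0 r) ⟩
  map f (map suc (interval 0 r))               ≡⟨ cong (map f) (map-suc-interval 0 r) ⟩
  map f (interval 1 r)                         ∎)
  where open ≡-Reasoning

∈-interval : ∀ {x} s r → x ∈ interval s r → s ≤ x × x < s + r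
∈-interval s (suc r) (here refl) = ≤-refl , subst (s <_) (sym (+-suc s r)) (s≤s (m≤m+n s r))
∈-interval {x} s (suc r) (there x∈) with ∈-interval (suc s) r x∈
... | s<x , x<end = <⇒≤ s<x , subst (x <_) (sym (+-suc s r)) x<end

#below-interval-none : ∀ {x} s r → x ≤ s → #below x (interval s r) ≡ 0
#below-interval-none s r x≤s =
  cong length (filter-none (_<? _) (All.tabulate λ y∈ → ≤⇒≯ (≤-trans x≤s (proj₁ (∈-interval s r y∈)))))

#below-interval : ∀ {x} s r → s ≤ x → x ≤ s + r → s + #below x (interval s r) ≡ x
#below-interval {x} s zero s≤x x≤s+0 = ≤-antisym (subst (_≤ x) (sym (+-identityʳ s)) s≤x) x≤s+0
#below-interval {x} s (suc r) s≤x x≤end with s <? x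
... | yes s<x = begin
  s + #below x (s ∷ interval (suc s) r)    ≡⟨ cong (s +_) (cong length (filter-accept (_<? x) s<x)) ⟩
  s + suc (#below x (interval (suc s) r))  ≡⟨ +-suc s _ ⟩
  suc s + #below x (interval (suc s) r)    ≡⟨ #below-interval (suc s) r s<x (subst (x ≤_) (+-suc s r) x≤end) ⟩
  x                                        ∎
  where open ≡-Reasoning
... | no s≮x = begin
  s + #below x (s ∷ interval (suc s) r)    ≡⟨ cong (s +_) (cong length (filter-reject (_<? x) s≮x)) ⟩
  s + #below x (interval (suc s) r)        ≡⟨ cong (s +_) (#below-interval-none (suc s) r (≤-trans (≮⇒≥ s≮x) (n≤1+n s))) ⟩
  s + 0                                    ≡⟨ +-identityʳ s ⟩
  s                                        ≡⟨ ≤-antisym s≤x (≮⇒≥ s≮x) ⟩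
  x                                        ∎
  where open ≡-Reasoning

#smaller-∷-< : ∀ {n x y} (xs : Vec ℕ n) → x < y → #smaller y (x ∷ xs) ≡ suc (#smaller y xs)
#smaller-∷-< {x = x} {y} xs x<y rewrite dec-true (x <? y) x<y = refl

#smaller-∷-≮ : ∀ {n x y} (xs : Vec ℕ n) → ¬ x < y → #smaller y (x ∷ xs) ≡ #smaller y xs
#smaller-∷-≮ {x = x} {y} xs x≮y rewrite dec-false (x <? y) x≮y = refl

#smaller-toList : ∀ {n} x (v : Vec ℕ n) → #smaller x v ≡ #below x (toList v)
#smaller-toList x [] = refl
#smaller-toList x (y ∷ ys) with y <? x
... | yes y<x = begin
  #smaller x (y ∷ ys)          ≡⟨ #smaller-∷-< ys y<x ⟩
  suc (#smaller x ys)          ≡⟨ cong suc (#smaller-toList x ys) ⟩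
  suc (#below x (toList ys))   ≡⟨ cong length (filter-accept (_<? x) y<x) ⟨
  #below x (y ∷ toList ys)     ∎
  where open ≡-Reasoning
... | no y≮x = begin
  #smaller x (y ∷ ys)          ≡⟨ #smaller-∷-≮ ys y≮x ⟩
  #smaller x ys                ≡⟨ #smaller-toList x ys ⟩
  #below x (toList ys)         ≡⟨ cong length (filter-reject (_<? x) y≮x) ⟨
  #below x (y ∷ toList ys)     ∎
  where open ≡-Reasoning

#smaller-mono : ∀ {n x y} → x ≤ y → (v : Vec ℕ n) → #smaller x v ≤ #smaller y v
#smaller-mono x≤y [] = z≤n
#smaller-mono {x = x} {y} x≤y (z ∷ zs) with z <? x | z <? y
... | yes z<x | _ rewrite #smaller-∷-< zs z<x | #smaller-∷-< {y = y} zs (<-≤-trans z<x x≤y) =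
  s≤s (#smaller-mono x≤y zs)
... | no z≮x | yes z<y rewrite #smaller-∷-≮ zs z≮x | #smaller-∷-< zs z<y =
  m≤n⇒m≤1+n (#smaller-mono x≤y zs)
... | no z≮x | no z≮y rewrite #smaller-∷-≮ zs z≮x | #smaller-∷-≮ zs z≮y =
  #smaller-mono x≤y zs

#smaller-none : ∀ {n y} (v : Vec ℕ n) → (∀ j → y ≤ lookup v j) → #smaller y v ≡ 0
#smaller-none []       _  = refl
#smaller-none (x ∷ xs) y≤ =
  trans (#smaller-∷-≮ xs (≤⇒≯ (y≤ fzero))) (#smaller-none xs (y≤ ∘ fsuc))

NonDecreasing Increasing : ∀ {n} → Vec ℕ n → Set
NonDecreasing {n} v = ∀ (i j : Fin n) → i ≤ᶠ j → lookup v i ≤ lookup v j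
Increasing    {n} v = ∀ (i j : Fin n) → i <ᶠ j → lookup v i < lookup v j

increasing⇒nonDecreasing : ∀ {n} {v : Vec ℕ n} → Increasing v → NonDecreasing v
increasing⇒nonDecreasing {v = v} inc i j i≤j with m≤n⇒m<n∨m≡n i≤j
... | inj₁ i<j = <⇒≤ (inc i j i<j)
... | inj₂ i≡j = ≤-reflexive (cong (lookup v) (toℕ-injective i≡j))

nonDecreasing-tail : ∀ {n x} {xs : Vec ℕ n} → NonDecreasing (x ∷ xs) → NonDecreasing xs
nonDecreasing-tail nd i j i≤j = nd (fsuc i) (fsuc j) (s≤s i≤j)

#smaller-lower : ∀ {n y} (v : Vec ℕ n) → NonDecreasing v →
                 ∀ i → lookup v i < y → suc (toℕ i) ≤ #smaller y v
#smaller-lower (x ∷ xs) nd fzero x<y = subst (1 ≤_) (sym (#smaller-∷-< xs x<y)) (s≤s z≤n)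
#smaller-lower (x ∷ xs) nd (fsuc i) xᵢ<y =
  subst (suc (suc (toℕ i)) ≤_) (sym (#smaller-∷-< xs (≤-<-trans (nd fzero (fsuc i) z≤n) xᵢ<y)))
    (s≤s (#smaller-lower xs (nonDecreasing-tail nd) i xᵢ<y))

#smaller-upper : ∀ {n y} (v : Vec ℕ n) → NonDecreasing v →
                 ∀ i → y ≤ lookup v i → #smaller y v ≤ toℕ i
#smaller-upper (x ∷ xs) nd fzero y≤x =
  ≤-reflexive (trans (#smaller-∷-≮ xs (≤⇒≯ y≤x))
                     (#smaller-none xs (λ j → ≤-trans y≤x (nd fzero (fsuc j) z≤n))))
#smaller-upper {y = y} (x ∷ xs) nd (fsuc i) y≤xᵢ with x <? y
... | yes x<y = subst (_≤ suc (toℕ i)) (sym (#smaller-∷-< xs x<y))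
                  (s≤s (#smaller-upper xs (nonDecreasing-tail nd) i y≤xᵢ))
... | no x≮y  = subst (_≤ suc (toℕ i)) (sym (#smaller-∷-≮ xs x≮y))
                  (m≤n⇒m≤1+n (#smaller-upper xs (nonDecreasing-tail nd) i y≤xᵢ))

#smaller-rank : ∀ {n} (v : Vec ℕ n) → Increasing v → ∀ i → #smaller (lookup v i) v ≡ toℕ i
#smaller-rank (x ∷ xs) inc fzero =
  trans (#smaller-∷-≮ xs (<-irrefl refl)) (#smaller-none xs (λ j → <⇒≤ (inc fzero (fsuc j) (s≤s z≤n))))
#smaller-rank (x ∷ xs) inc (fsuc i) =
  trans (#smaller-∷-< xs (inc fzero (fsuc i) (s≤s z≤n)))
        (cong suc (#smaller-rank xs (λ i j i<j → inc (fsuc i) (fsuc j) (s≤s i<j)) i))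

lookup-ext : ∀ {n} (u v : Vec ℕ n) → (∀ i → lookup u i ≡ lookup v i) → u ≡ v
lookup-ext u v same = begin
  u                    ≡⟨ tabulate∘lookup u ⟨
  tabulate (lookup u)  ≡⟨ tabulate-cong same ⟩
  tabulate (lookup v)  ≡⟨ tabulate∘lookup v ⟩
  v                    ∎
  where open ≡-Reasoning

increasing-determined : ∀ {n} (S : ℕ → Set) (v w : Vec ℕ n) → Increasing v → Increasing w →
  (∀ i → S (lookup v i)) → (∀ i → S (lookup w i)) →
  (∀ x → S x → #smaller x v ≡ #smaller x w) → v ≡ w
increasing-determined {n} S v w inc-v inc-w S-v S-w same = lookup-ext v w entrywise
  where
  -- if u_i < u'_i then u'_i would exceed i+1 entries of u but only i of u'
  not-below : ∀ (u u' : Vec ℕ n) → Increasing u → Increasing u' →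
              (∀ i → #smaller (lookup u' i) u ≡ #smaller (lookup u' i) u') →
              ∀ i → ¬ lookup u i < lookup u' i
  not-below u u' inc inc' same' i uᵢ<u'ᵢ = <-irrefl refl (begin-strict
    toℕ i                       <⟨ #smaller-lower u (increasing⇒nonDecreasing {v = u} inc) i uᵢ<u'ᵢ ⟩
    #smaller (lookup u' i) u    ≡⟨ same' i ⟩
    #smaller (lookup u' i) u'   ≡⟨ #smaller-rank u' inc' i ⟩
    toℕ i                       ∎)
    where open ≤-Reasoning
  entrywise : ∀ i → lookup v i ≡ lookup w i
  entrywise i with <-cmp (lookup v i) (lookup w i)
  ... | tri< vᵢ<wᵢ _ _ = ⊥-elim (not-below v w inc-v inc-w (λ j → same _ (S-w j)) i vᵢ<wᵢ)
  ... | tri≈ _ vᵢ≡wᵢ _ = vᵢ≡wᵢ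
  ... | tri> _ _ wᵢ<vᵢ = ⊥-elim (not-below w v inc-w inc-v (λ j → sym (same _ (S-v j))) i wᵢ<vᵢ)

module _ {n : ℕ} {T : Filling n} (syt : IsSYT T) where
  open IsSYT syt

  entries-interval : toList (col₁ T) ++ toList (col₂ T) ↭ interval 1 (n + n)
  entries-interval = subst (toList (col₁ T) ++ toList (col₂ T) ↭_) (range≡interval (n + n)) entries

  entry-range : ∀ {x} → x ∈ toList (col₁ T) ++ toList (col₂ T) → 1 ≤ x × x ≤ n + n
  entry-range x∈ with ∈-interval 1 (n + n) (∈-resp-↭ entries-interval x∈)
  ... | 1≤x , x<1+2n = 1≤x , ≤-pred x<1+2n

  col₁-range : ∀ i → 1 ≤ lookup (col₁ T) i × lookup (col₁ T) i ≤ n + n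
  col₁-range i = entry-range (∈-++⁺ˡ (∈-toList⁺ (∈-lookup i (col₁ T))))

  col₂-range : ∀ i → 1 ≤ lookup (col₂ T) i × lookup (col₂ T) i ≤ n + n
  col₂-range i = entry-range (∈-++⁺ʳ (toList (col₁ T)) (∈-toList⁺ (∈-lookup i (col₂ T))))

  #entries-below : ∀ {x} → 1 ≤ x → x ≤ suc (n + n) →
                   suc (#smaller x (col₁ T) + #smaller x (col₂ T)) ≡ x
  #entries-below {x} 1≤x x≤2n+1 = begin
    suc (#smaller x (col₁ T) + #smaller x (col₂ T))
      ≡⟨ cong₂ (λ a b → suc (a + b)) (#smaller-toList x (col₁ T)) (#smaller-toList x (col₂ T)) ⟩
    suc (#below x (toList (col₁ T)) + #below x (toList (col₂ T)))
      ≡⟨ cong suc (#below-++ x (toList (col₁ T)) (toList (col₂ T))) ⟨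
    suc (#below x (toList (col₁ T) ++ toList (col₂ T)))
      ≡⟨ cong suc (#below-↭ x entries-interval) ⟩
    suc (#below x (interval 1 (n + n)))
      ≡⟨ #below-interval 1 (n + n) 1≤x x≤2n+1 ⟩
    x ∎
    where open ≡-Reasoning

secondBelow : ∀ {n} → Filling n → Fin n → ℕ
secondBelow T i = #smaller (lookup (col₁ T) i) (col₂ T)

-- a_i = 1 + i + q_i: below a_i lie the i entries above it in its column and
-- q_i entries of the second column.
col₁-entry : ∀ {n} {T : Filling n} → IsSYT T → ∀ i → lookup (col₁ T) i ≡ suc (toℕ i + secondBelow T i)
col₁-entry {T = T} syt i = sym (begin
  suc (toℕ i + secondBelow T i)                                   ≡⟨ cong (λ r → suc (r + secondBelow T i)) (#smaller-rank (col₁ T) (IsSYT.col₁Inc syt) i) ⟨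
  suc (#smaller aᵢ (col₁ T) + #smaller aᵢ (col₂ T))               ≡⟨ #entries-below syt (proj₁ (col₁-range syt i)) (m≤n⇒m≤1+n (proj₂ (col₁-range syt i))) ⟩
  aᵢ                                                              ∎)
  where
  open ≡-Reasoning
  aᵢ : ℕ
  aᵢ = lookup (col₁ T) i

pos-difference : ∀ m n c → (ℤ.+ m ℤ.- ℤ.+ n ≡ ℤ.+ c) ⇔ (m ≡ c + n)
pos-difference m n c = mk⇔ to from
  where
  open +-*-Solver
  open ≡-Reasoning
  to : ℤ.+ m ℤ.- ℤ.+ n ≡ ℤ.+ c → m ≡ c + n
  to diff = ℤ.+-injective (begin
    ℤ.+ m                            ≡⟨ solve 2 (λ x y → x := (x :- y) :+ y) refl (ℤ.+ m) (ℤ.+ n) ⟩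
    (ℤ.+ m ℤ.- ℤ.+ n) ℤ.+ ℤ.+ n      ≡⟨ cong (ℤ._+ ℤ.+ n) diff ⟩
    ℤ.+ c ℤ.+ ℤ.+ n                  ≡⟨ ℤ.pos-+ c n ⟨
    ℤ.+ (c + n)                      ∎)
  from : m ≡ c + n → ℤ.+ m ℤ.- ℤ.+ n ≡ ℤ.+ c
  from refl = begin
    ℤ.+ (c + n) ℤ.- ℤ.+ n            ≡⟨ cong (ℤ._- ℤ.+ n) (ℤ.pos-+ c n) ⟩
    (ℤ.+ c ℤ.+ ℤ.+ n) ℤ.- ℤ.+ n      ≡⟨ solve 2 (λ x y → (x :+ y) :- y := x) refl (ℤ.+ c) (ℤ.+ n) ⟩
    ℤ.+ c                            ∎

-- Since dep(a_i) = i - q_i, the depth condition says i = c_i + q_i.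
hasDeps⇔ : ∀ {n} {T : Filling n} (c : Fin n → ℕ) → IsSYT T →
           HasDeps c T ⇔ (∀ i → toℕ i ≡ c i + secondBelow T i)
hasDeps⇔ {T = T} c syt = mk⇔
  (λ deps i → Equivalence.to (pos-difference _ _ (c i)) (trans (sym (dep-aᵢ i)) (deps i)))
  (λ rows i → trans (dep-aᵢ i) (Equivalence.from (pos-difference _ _ (c i)) (rows i)))
  where
  dep-aᵢ : ∀ i → dep₁ T (lookup (col₁ T) i) ≡ ℤ.+ toℕ i ℤ.- ℤ.+ secondBelow T i
  dep-aᵢ i = cong (λ r → ℤ.+ r ℤ.- ℤ.+ secondBelow T i) (#smaller-rank (col₁ T) (IsSYT.col₁Inc syt) i)

-- Necessity: q_0 = 0 forces c_0 = 0, and since q is monotone along the first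
-- column, c_{i+1} + q_{i+1} = c_i + q_i + 1 forces c_{i+1} ≤ c_i + 1.
depCondition-necessary : ∀ {n} {T : Filling n} {c : Fin n → ℕ} → IsSYT T → HasDeps c T → DepCondition c
depCondition-necessary {T = T} {c} syt deps = first-is-zero , step-at-most-one
  where
  q : Fin _ → ℕ
  q = secondBelow T
  rows : ∀ i → toℕ i ≡ c i + q i
  rows = Equivalence.to (hasDeps⇔ c syt) deps
  first-is-zero : ∀ i → toℕ i ≡ 0 → c i ≡ 0
  first-is-zero i i≡0 = m+n≡0⇒m≡0 (c i) (trans (sym (rows i)) i≡0)
  step-at-most-one : ∀ i j → toℕ j ≡ suc (toℕ i) → c j ≤ suc (c i)
  step-at-most-one i j j≡1+i = +-cancelʳ-≤ (q j) (c j) (suc (c i)) (begin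
    c j + q j        ≡⟨ rows j ⟨
    toℕ j            ≡⟨ j≡1+i ⟩
    suc (toℕ i)      ≡⟨ cong suc (rows i) ⟩
    suc (c i + q i)  ≤⟨ s≤s (+-monoʳ-≤ (c i) qᵢ≤qⱼ) ⟩
    suc (c i + q j)  ∎)
    where
    open ≤-Reasoning
    qᵢ≤qⱼ : q i ≤ q j
    qᵢ≤qⱼ = #smaller-mono (<⇒≤ (IsSYT.col₁Inc syt i j (subst (toℕ i <_) (sym j≡1+i) ≤-refl))) (col₂ T)

col₁-determined : ∀ {n} {T : Filling n} {c : Fin n → ℕ} → IsSYT T → HasDeps c T →
                  ∀ i → lookup (col₁ T) i ≡ suc (toℕ i + (toℕ i ∸ c i))
col₁-determined {T = T} {c} syt deps i =
  trans (col₁-entry syt i) (cong (λ r → suc (toℕ i + r)) qᵢ≡i∸cᵢ)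
  where
  qᵢ≡i∸cᵢ : secondBelow T i ≡ toℕ i ∸ c i
  qᵢ≡i∸cᵢ = sym (trans (cong (_∸ c i) (Equivalence.to (hasDeps⇔ c syt) deps i))
                       (m+n∸m≡n (c i) (secondBelow T i)))

-- A standard tableau of shape 2^n is determined by its first column: the
-- second column has the complementary counting function on 1, …, 2n.
determined-by-col₁ : ∀ {n} {T T' : Filling n} → IsSYT T → IsSYT T' → col₁ T ≡ col₁ T' → T ≡ T'
determined-by-col₁ {n} {u , v} {.u , v'} syt syt' refl =
  cong (u ,_) (increasing-determined InRange v v' (IsSYT.col₂Inc syt) (IsSYT.col₂Inc syt')
                 (col₂-range syt) (col₂-range syt') same-count)
  where
  InRange : ℕ → Set
  InRange x = 1 ≤ x × x ≤ n + n
  same-count : ∀ x → InRange x → #smaller x v ≡ #smaller x v'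
  same-count x (1≤x , x≤2n) = +-cancelˡ-≡ (#smaller x u) _ _ (suc-injective
    (trans (#entries-below syt 1≤x (m≤n⇒m≤1+n x≤2n)) (sym (#entries-below syt' 1≤x (m≤n⇒m≤1+n x≤2n)))))

syt-unique : ∀ {n} {T T' : Filling n} {c : Fin n → ℕ} →
             IsSYT T → HasDeps c T → IsSYT T' → HasDeps c T' → T ≡ T'
syt-unique syt deps syt' deps' = determined-by-col₁ syt syt' (lookup-ext _ _ λ i →
  trans (col₁-determined syt deps i) (sym (col₁-determined syt' deps' i)))

-- Given a monotone k with k_i ≤ i, put a_i = 1 + i + k_i and
-- b_j = 1 + j + m_j, where m_j = #{i < n : k_i ≤ j}.  Reading 1, 2, …, 2n in
-- order, the next number is a_i if k_i = j and b_j otherwise (i, j counting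
-- the a's and b's already read), so the two columns interleave to 1, …, 2n.
module Ballot (n : ℕ) (k : ℕ → ℕ) (k-mono : ∀ {i j} → i ≤ j → k i ≤ k j) (k≤id : ∀ i → k i ≤ i) where

  κ : Vec ℕ n
  κ = tabulate (k ∘ toℕ)

  κ-nonDecreasing : NonDecreasing κ
  κ-nonDecreasing i j i≤j rewrite lookup∘tabulate (k ∘ toℕ) i | lookup∘tabulate (k ∘ toℕ) j = k-mono i≤j

  κ-at : ∀ {i} (i<n : i < n) → lookup κ (fromℕ< i<n) ≡ k i
  κ-at i<n = trans (lookup∘tabulate (k ∘ toℕ) (fromℕ< i<n)) (cong k (toℕ-fromℕ< i<n))

  m : ℕ → ℕ
  m j = #smaller (suc j) κ

  m-mono : ∀ {j j'} → j ≤ j' → m j ≤ m j'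
  m-mono j≤j' = #smaller-mono (s≤s j≤j') κ

  m-lower : ∀ {i j} → i < n → k i ≤ j → suc i ≤ m j
  m-lower {i} {j} i<n kᵢ≤j = subst (λ r → suc r ≤ m j) (toℕ-fromℕ< i<n)
    (#smaller-lower κ κ-nonDecreasing (fromℕ< i<n) (s≤s (subst (_≤ j) (sym (κ-at i<n)) kᵢ≤j)))

  m-upper : ∀ {i j} → i < n → j < k i → m j ≤ i
  m-upper {i} {j} i<n j<kᵢ = subst (m j ≤_) (toℕ-fromℕ< i<n)
    (#smaller-upper κ κ-nonDecreasing (fromℕ< i<n) (subst (suc j ≤_) (sym (κ-at i<n)) j<kᵢ))

  a b : ℕ → ℕ
  a i = suc (i + k i)
  b j = suc (j + m j)

  a-at : ∀ {s i j} → k i ≡ j → s ≡ suc (i + j) → a i ≡ s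
  a-at {i = i} kᵢ≡j s≡ = trans (cong (λ r → suc (i + r)) kᵢ≡j) (sym s≡)

  b-at : ∀ {s i j} → m j ≡ i → s ≡ suc (i + j) → b j ≡ s
  b-at {i = i} {j} mⱼ≡i s≡ = trans (cong (λ r → suc (j + r)) mⱼ≡i) (trans (cong suc (+-comm j i)) (sym s≡))

  next-start : ∀ {s i j} → s ≡ suc (i + j) → suc s ≡ suc (i + suc j)
  next-start {i = i} {j} s≡ = cong suc (trans s≡ (sym (+-suc i j)))

  row-exists : ∀ {i p} → i + suc p ≡ n → i < n
  row-exists {i} {p} e = subst (i <_) e (m<m+n i (s≤s z≤n))

  -- After reading a_0 … a_{i-1} and b_0 … b_{j-1} (with p and q entries left in
  -- the columns), the numbers s, s+1, … still to come interleave the rest.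
  -- The invariants say that a_i is not yet due before b_j, and vice versa.
  merge : ∀ s i j p q → s ≡ suc (i + j) → i + p ≡ n → j + q ≡ n →
          (0 < p → j ≤ k i) → (0 < q → i ≤ m j) →
          Interleaving (map a (interval i p)) (map b (interval j q)) (interval s (p + q))
  merge s i j zero zero _ _ _ _ _ = []
  merge s i j zero (suc q) s≡ i+0≡n j+q≡n _ i≤mⱼ =
    b-at mⱼ≡i s≡ ∷ʳ merge (suc s) i (suc j) zero q (next-start s≡) i+0≡n (trans (sym (+-suc j q)) j+q≡n)
                      (λ ()) (λ _ → ≤-trans (i≤mⱼ (s≤s z≤n)) (m-mono (n≤1+n j)))
    where
    mⱼ≡i : m j ≡ i
    mⱼ≡i = ≤-antisym (subst (m j ≤_) (trans (sym i+0≡n) (+-identityʳ i)) (count≤n (_<? suc j) κ)) (i≤mⱼ (s≤s z≤n))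
  merge s i j (suc p) q s≡ i+p≡n j+q≡n j≤kᵢ i≤mⱼ with k i ≟ j
  ... | yes kᵢ≡j =
    a-at kᵢ≡j s≡ ∷ˡ merge (suc s) (suc i) j p q (cong suc s≡) (trans (sym (+-suc i p)) i+p≡n) j+q≡n
                      (λ _ → subst (_≤ k (suc i)) kᵢ≡j (k-mono (n≤1+n i)))
                      (λ _ → m-lower (row-exists i+p≡n) (≤-reflexive kᵢ≡j))
  merge s i j (suc p) zero s≡ i+p≡n j+0≡n j≤kᵢ i≤mⱼ | no kᵢ≢j =
    ⊥-elim (<-irrefl (trans (sym (+-identityʳ j)) j+0≡n) (<-≤-trans j<kᵢ (≤-trans (k≤id i) (<⇒≤ (row-exists i+p≡n)))))
    where
    j<kᵢ : j < k i
    j<kᵢ = ≤∧≢⇒< (j≤kᵢ (s≤s z≤n)) (kᵢ≢j ∘ sym)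
  merge s i j (suc p) (suc q) s≡ i+p≡n j+q≡n j≤kᵢ i≤mⱼ | no kᵢ≢j rewrite +-suc p q =
    b-at (≤-antisym (m-upper (row-exists i+p≡n) j<kᵢ) (i≤mⱼ (s≤s z≤n))) s≡
      ∷ʳ merge (suc s) i (suc j) (suc p) q (next-start s≡) i+p≡n (trans (sym (+-suc j q)) j+q≡n)
           (λ _ → j<kᵢ) (λ _ → ≤-trans (i≤mⱼ (s≤s z≤n)) (m-mono (n≤1+n j)))
    where
    j<kᵢ : j < k i
    j<kᵢ = ≤∧≢⇒< (j≤kᵢ (s≤s z≤n)) (kᵢ≢j ∘ sym)

  ballot-tableau : Σ (Filling n) λ T → IsSYT T × (∀ i → lookup (col₁ T) i ≡ suc (toℕ i + k (toℕ i)))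
  ballot-tableau = T , syt , lookup∘tabulate (a ∘ toℕ)
    where
    T : Filling n
    T = tabulate (a ∘ toℕ) , tabulate (b ∘ toℕ)
    columns-merge : (map a (interval 0 n) ++ map b (interval 0 n)) ↭ interval 1 (n + n)
    columns-merge = ↭-sym (toPermutation (merge 1 0 0 n n refl refl refl (λ _ → z≤n) (λ _ → z≤n)))
    syt : IsSYT T
    syt = record
      { entries = subst₂ _↭_ (sym (cong₂ _++_ (toList-tabulate {n} a) (toList-tabulate {n} b)))
                             (sym (range≡interval (n + n))) columns-merge
      ; rowsInc = λ i → subst₂ _<_ (sym (lookup∘tabulate (a ∘ toℕ) i)) (sym (lookup∘tabulate (b ∘ toℕ) i))
                          (s≤s (+-monoʳ-< (toℕ i) (<-≤-trans (s≤s (k≤id (toℕ i))) (m-lower (toℕ<n i) (k≤id (toℕ i))))))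
      ; col₁Inc = λ i j i<j → subst₂ _<_ (sym (lookup∘tabulate (a ∘ toℕ) i)) (sym (lookup∘tabulate (a ∘ toℕ) j))
                                (s≤s (+-mono-<-≤ i<j (k-mono (<⇒≤ i<j))))
      ; col₂Inc = λ i j i<j → subst₂ _<_ (sym (lookup∘tabulate (b ∘ toℕ) i)) (sym (lookup∘tabulate (b ∘ toℕ) j))
                                (s≤s (+-mono-<-≤ i<j (m-mono (<⇒≤ i<j))))
      }

extend : ∀ {n} → (Fin n → ℕ) → ℕ → ℕ
extend {zero}  c i       = 0
extend {suc n} c zero    = c fzero
extend {suc n} c (suc i) = extend (c ∘ fsuc) i

extend-toℕ : ∀ {n} (c : Fin n → ℕ) i → extend c (toℕ i) ≡ c i
extend-toℕ c fzero    = refl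
extend-toℕ c (fsuc i) = extend-toℕ (c ∘ fsuc) i

extend-at-0 : ∀ {n} (c : Fin n → ℕ) → (∀ i → toℕ i ≡ 0 → c i ≡ 0) → extend c 0 ≡ 0
extend-at-0 {zero}  c _          = refl
extend-at-0 {suc n} c first-zero = first-zero fzero refl

extend-step : ∀ {n} (c : Fin n → ℕ) → (∀ i j → toℕ j ≡ suc (toℕ i) → c j ≤ suc (c i)) →
              ∀ i → extend c (suc i) ≤ suc (extend c i)
extend-step {zero}        c _    _       = z≤n
extend-step {suc zero}    c _    zero    = z≤n
extend-step {suc (suc n)} c step zero    = step fzero (fsuc fzero) refl
extend-step {suc n}       c step (suc i) = extend-step (c ∘ fsuc) (λ i j e → step (fsuc i) (fsuc j) (cong suc e)) i

bounded-by-index : ∀ (C : ℕ → ℕ) → C 0 ≡ 0 → (∀ i → C (suc i) ≤ suc (C i)) → ∀ i → C i ≤ i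
bounded-by-index C C₀≡0 step zero    = ≤-reflexive C₀≡0
bounded-by-index C C₀≡0 step (suc i) = ≤-trans (step i) (s≤s (bounded-by-index C C₀≡0 step i))

monotone-from-steps : ∀ (f : ℕ → ℕ) → (∀ i → f i ≤ f (suc i)) → ∀ {i j} → i ≤ j → f i ≤ f j
monotone-from-steps f step {j = zero}  z≤n = ≤-refl
monotone-from-steps f step {i} {suc j} i≤1+j with m≤n⇒m<n∨m≡n i≤1+j
... | inj₁ i<1+j = ≤-trans (monotone-from-steps f step (≤-pred i<1+j)) (step j)
... | inj₂ refl  = ≤-refl

-- Sufficiency: for k_i = i - c_i the ballot tableau has the prescribed depths,
-- because its first column has q_i = k_i and c_i ≤ i.
existence : ∀ {n} (c : Fin n → ℕ) → DepCondition c → Σ (Filling n) λ T → IsSYT T × HasDeps c T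
existence {n} c (first-zero , step) = T , syt , Equivalence.from (hasDeps⇔ c syt) rows
  where
  C : ℕ → ℕ
  C = extend c
  C-step : ∀ i → C (suc i) ≤ suc (C i)
  C-step = extend-step c step
  cᵢ≤i : ∀ i → c i ≤ toℕ i
  cᵢ≤i i = subst (_≤ toℕ i) (extend-toℕ c i) (bounded-by-index C (extend-at-0 c first-zero) C-step (toℕ i))
  k : ℕ → ℕ
  k i = i ∸ C i
  k-mono : ∀ {i j} → i ≤ j → k i ≤ k j
  k-mono = monotone-from-steps k (λ i → ∸-monoʳ-≤ (suc i) (C-step i))
  tableau : Σ (Filling n) λ T → IsSYT T × (∀ i → lookup (col₁ T) i ≡ suc (toℕ i + k (toℕ i)))
  tableau = Ballot.ballot-tableau n k k-mono (λ i → m∸n≤m i (C i))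
  T : Filling n
  T = proj₁ tableau
  syt : IsSYT T
  syt = proj₁ (proj₂ tableau)
  qᵢ≡kᵢ : ∀ i → secondBelow T i ≡ k (toℕ i)
  qᵢ≡kᵢ i = +-cancelˡ-≡ (toℕ i) _ _ (suc-injective (trans (sym (col₁-entry syt i)) (proj₂ (proj₂ tableau) i)))
  rows : ∀ i → toℕ i ≡ c i + secondBelow T i
  rows i = begin
    toℕ i                          ≡⟨ m+[n∸m]≡n (cᵢ≤i i) ⟨
    c i + (toℕ i ∸ c i)            ≡⟨ cong (λ r → c i + (toℕ i ∸ r)) (extend-toℕ c i) ⟨
    c i + k (toℕ i)                ≡⟨ cong (c i +_) (qᵢ≡kᵢ i) ⟨
    c i + secondBelow T i          ∎
    where open ≡-Reasoning

-- The theorem: necessity from depCondition-necessary, sufficiency from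
-- existence together with syt-unique.
mainTheorem16 : (n : ℕ) → 1 ≤ n → (c : Fin n → ℕ) →
    (∃! _≡_ (λ (T : Filling n) → IsSYT T × HasDeps c T)) ⇔ DepCondition c
mainTheorem16 n _ c = mk⇔ necessary sufficient
  where
  necessary : ∃! _≡_ (λ (T : Filling n) → IsSYT T × HasDeps c T) → DepCondition c
  necessary (_ , (syt , deps) , _) = depCondition-necessary syt deps
  sufficient : DepCondition c → ∃! _≡_ (λ (T : Filling n) → IsSYT T × HasDeps c T)
  sufficient dc with existence c dc
  ... | T , syt , deps = T , (syt , deps) , λ (syt' , deps') → syt-unique syt deps syt' deps'
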